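{- Let $M$ be a max shuffle on $S_n$, $w\in S_n$, and $k:=w(1)$. If $w(1)\ge M(w)(1)$, then $M^{k-1}(w)(1)=1$.
   Context: $[n]=\{1,\dots,n\}$, $[a,b]=\{a,\dots,b\}$; $S_n$ is the group of bijections $[n]\to[n]$. A homing shuffle is a map $F:S_n\to S_n$ such that for every $w\in S_n$, setting $k:=w(1)$: (a) $F(w)(k)=k$, and (b) $F(w)(i)=w(i)$ for all $i>k$. A max shuffle is a homing shuffle $M$ such that for every $w\in S_n$ with $w(1)\neq1$, $M(w)(1)=\max(w([2,k]))$ where $k=w(1)$. $M^m$ denotes the $m$-th iterate of $M$. -}

module Defs where

open import Data.Nat using (ℕ; zero; suc; _⊔_)
import Data.Nat as ℕ
open import Data.Fin using (Fin; toℕ; _<_; _≤_; _≟_)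
import Data.Fin as Fin
open import Data.Fin.Permutation using (Permutation′; _⟨$⟩ʳ_)
open import Data.List using (List; foldr; map; filter; allFin)
open import Data.Product using (_×_)
open import Relation.Binary.PropositionalEquality using (_≡_)
open import Relation.Nullary using (¬_)
open import Relation.Nullary.Decidable using (_×-dec_)

-- Points of [N] = {1,…,N} are encoded 0-based: the point j ∈ [N] is the Fin N element
-- with toℕ = j - 1.  In particular the point 1 is Fin.zero.  The order on Fin agrees
-- with the order on [N] under this shift.
S : ℕ → Set
S N = Permutation′ N

first : ∀ {n} → S (suc n) → Fin (suc n)
first w = w ⟨$⟩ʳ Fin.zero

IsHomingShuffle : ∀ {n} → (S (suc n) → S (suc n)) → Set
IsHomingShuffle {n} F =
  ∀ (w : S (suc n)) →
    (F w ⟨$⟩ʳ first w ≡ first w)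
    × (∀ (i : Fin (suc n)) → first w < i → F w ⟨$⟩ʳ i ≡ w ⟨$⟩ʳ i)

-- max(w([2,k])) where k = w(1), as a 0-based value (toℕ):
-- maximum of toℕ (w j) over positions j with 1 ≤ toℕ j ≤ toℕ (w(1))
-- (0-based encoding of the positions 2,…,k).  For w(1) ≠ 1 this set is nonempty.
maxPrefix : ∀ {n} → S (suc n) → ℕ
maxPrefix {n} w =
  foldr _⊔_ 0
    (map (λ j → toℕ (w ⟨$⟩ʳ j))
      (filter (λ j → (1 ℕ.≤? toℕ j) ×-dec (toℕ j ℕ.≤? toℕ (first w))) (allFin (suc n))))

IsMaxShuffle : ∀ {n} → (S (suc n) → S (suc n)) → Set
IsMaxShuffle {n} M =
  IsHomingShuffle M
  × (∀ (w : S (suc n)) → ¬ (first w ≡ Fin.zero) → toℕ (first (M w)) ≡ maxPrefix w)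

iter : ∀ {A : Set} → (A → A) → ℕ → A → A
iter f zero x = x
iter f (suc m) x = f (iter f m x)

-- Say that w is b-stable if it maps [1, b] into itself.  With k = w(1), the hypothesis makes
-- w k-stable, since w(i) ≤ max(w([2, k])) = M(w)(1) ≤ k for 2 ≤ i ≤ k.  A homing step fixes
-- k and agrees with w above k, so M(w) is again k-stable, hence (k − 1)-stable.  By pigeonhole
-- max(w([2, k])) ≥ k − 1, so M(w)(1) = k − 1 and M(w) is in the same situation with k − 1
-- in place of k; after k − 1 steps the first entry is 1.
module Submission where

open import Defs
open import Data.Nat using (ℕ; zero; suc; _⊔_; z≤n; s≤s; s≤s⁻¹)
import Data.Nat as ℕ
open import Data.Nat.Properties
  using (≤-refl; ≤-trans; ≤-antisym; n≤1+n; m≤m⊔n; m≤n⊔m; ≤∧≢⇒<; ≰⇒>; 1+n≰n; 1+n≢0; n≮0)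
open import Data.Fin using (Fin; toℕ; _≤_; _<_)
import Data.Fin as Fin
open import Data.Fin.Properties
  using (toℕ-injective; suc-injective; toℕ-fromℕ<; toℕ<n; injective⇒existsPivot)
open import Data.Fin.Permutation using (_⟨$⟩ʳ_; _⟨$⟩ˡ_; inverseʳ)
open import Data.List using (_∷_; foldr)
open import Data.List.Membership.Propositional using (_∈_)
open import Data.List.Membership.Propositional.Properties
  using (∈-map⁺; ∈-filter⁺; ∈-allFin)
open import Data.List.Relation.Unary.Any using (here; there)
open import Data.Product using (_×_; _,_; proj₁; proj₂)
open import Function using (_∘_)
open import Function.Bundles using (Injection)
open import Function.Properties.Inverse using (Inverse⇒Injection)
open import Relation.Binary.PropositionalEquality using (_≡_; _≢_; refl; sym; trans; cong; subst)
open import Relation.Nullary using (Dec; yes; no; contradiction)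
open import Relation.Nullary.Decidable using (_×-dec_)

∈⇒≤foldr-⊔ : ∀ {x xs} → x ∈ xs → x ℕ.≤ foldr _⊔_ 0 xs
∈⇒≤foldr-⊔ {xs = y ∷ ys} (here refl)  = m≤m⊔n y _
∈⇒≤foldr-⊔ {xs = y ∷ ys} (there x∈ys) = ≤-trans (∈⇒≤foldr-⊔ x∈ys) (m≤n⊔m y _)

iter-suc : ∀ {A : Set} (f : A → A) m x → iter f (suc m) x ≡ iter f m (f x)
iter-suc f zero    x = refl
iter-suc f (suc m) x = cong f (iter-suc f m x)

module _ {n : ℕ} where

  ⟨$⟩ʳ-injective : (v : S (suc n)) {i j : Fin (suc n)} → v ⟨$⟩ʳ i ≡ v ⟨$⟩ʳ j → i ≡ j
  ⟨$⟩ʳ-injective v = Injection.injective (Inverse⇒Injection v)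

  SegmentStable : S (suc n) → ℕ → Set
  SegmentStable v b = ∀ i → toℕ i ℕ.≤ b → toℕ (v ⟨$⟩ʳ i) ℕ.≤ b

  ≤maxPrefix : (v : S (suc n)) (i : Fin (suc n)) → 1 ℕ.≤ toℕ i → i ≤ first v →
               toℕ (v ⟨$⟩ʳ i) ℕ.≤ maxPrefix v
  ≤maxPrefix v i 1≤i i≤k =
    ∈⇒≤foldr-⊔ (∈-map⁺ (toℕ ∘ (v ⟨$⟩ʳ_)) (∈-filter⁺ inPrefix? (∈-allFin i) (1≤i , i≤k)))
    where
    inPrefix? = λ j → (1 ℕ.≤? toℕ j) ×-dec (toℕ j ℕ.≤? toℕ (first v))

  -- Pigeonhole, via a pivot of i ↦ v(i + 1): the k − 1 distinct values v(2), …, v(k)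
  -- cannot all lie below k − 1.
  maxPrefix-lowerBound : (v : S (suc n)) (j : ℕ) → toℕ (first v) ≡ suc j → j ℕ.≤ maxPrefix v
  maxPrefix-lowerBound v j k≡ = ≤-trans j≤vq (≤maxPrefix v (Fin.suc q) (s≤s z≤n) q<k)
    where
    j<n : j ℕ.< n
    j<n = s≤s⁻¹ (subst (ℕ._< suc n) k≡ (toℕ<n (first v)))
    pivot = injective⇒existsPivot
              (λ {x} {y} → suc-injective ∘ ⟨$⟩ʳ-injective v {Fin.suc x} {Fin.suc y})
              (Fin.fromℕ< j<n)
    q = proj₁ pivot
    q<k : Fin.suc q ≤ first v
    q<k = subst (suc (toℕ q) ℕ.≤_) (sym k≡)
                (s≤s (subst (toℕ q ℕ.≤_) (toℕ-fromℕ< j<n) (proj₁ (proj₂ pivot))))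
    j≤vq : j ℕ.≤ toℕ (v ⟨$⟩ʳ Fin.suc q)
    j≤vq = subst (ℕ._≤ toℕ (v ⟨$⟩ʳ Fin.suc q)) (toℕ-fromℕ< j<n) (proj₂ (proj₂ pivot))

  homing-segmentStable : (F : S (suc n) → S (suc n)) → IsHomingShuffle F →
                         ∀ w b → toℕ (first w) ≡ b → SegmentStable w b → SegmentStable (F w) b
  homing-segmentStable F homing w b k≡b stable i i≤b = bound (toℕ m ℕ.≤? b)
    where
    m = w ⟨$⟩ˡ (F w ⟨$⟩ʳ i)
    wm≡ui : w ⟨$⟩ʳ m ≡ F w ⟨$⟩ʳ i
    wm≡ui = inverseʳ w
    bound : Dec (toℕ m ℕ.≤ b) → toℕ (F w ⟨$⟩ʳ i) ℕ.≤ b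
    bound (yes m≤b) = subst (λ x → toℕ x ℕ.≤ b) wm≡ui (stable m m≤b)
    bound (no m≰b) = contradiction (subst (λ x → toℕ x ℕ.≤ b) (sym m≡i) i≤b) m≰b
      where
      k<m : first w < m
      k<m = subst (ℕ._< toℕ m) (sym k≡b) (≰⇒> m≰b)
      m≡i : m ≡ i
      m≡i = ⟨$⟩ʳ-injective (F w) (trans (proj₂ (homing w) m k<m) wm≡ui)

  segmentStable-pred : (u : S (suc n)) (c : Fin (suc n)) (j : ℕ) →
                       toℕ c ≡ suc j → u ⟨$⟩ʳ c ≡ c →
                       SegmentStable u (suc j) → SegmentStable u j
  segmentStable-pred u c j c≡ fixed stable i i≤j =
    s≤s⁻¹ (≤∧≢⇒< (stable i (≤-trans i≤j (n≤1+n j))) ui≢)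
    where
    ui≢ : toℕ (u ⟨$⟩ʳ i) ≢ suc j
    ui≢ ui≡ = 1+n≰n (subst (ℕ._≤ j) (trans (cong toℕ i≡c) c≡) i≤j)
      where
      i≡c : i ≡ c
      i≡c = ⟨$⟩ʳ-injective u (trans (toℕ-injective (trans ui≡ (sym c≡))) (sym fixed))

  module _ (M : S (suc n) → S (suc n)) (isMax : IsMaxShuffle M) where

    maxShuffle-step : ∀ v j → toℕ (first v) ≡ suc j → SegmentStable v (suc j) →
                      toℕ (first (M v)) ≡ j × SegmentStable (M v) j
    maxShuffle-step v j k≡ stable = ≤-antisym (stable′ Fin.zero z≤n) j≤first , stable′
      where
      stable′ : SegmentStable (M v) j
      stable′ = segmentStable-pred (M v) (first v) j k≡ (proj₁ (proj₁ isMax v))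
                  (homing-segmentStable M (proj₁ isMax) v (suc j) k≡ stable)
      k≢0 : first v ≢ Fin.zero
      k≢0 k≡0 = 1+n≢0 (trans (sym k≡) (cong toℕ k≡0))
      j≤first : j ℕ.≤ toℕ (first (M v))
      j≤first = subst (j ℕ.≤_) (sym (proj₂ isMax v k≢0)) (maxPrefix-lowerBound v j k≡)

    maxShuffle-iter-first : ∀ j v → toℕ (first v) ≡ j → SegmentStable v j →
                            iter M j v ⟨$⟩ʳ Fin.zero ≡ Fin.zero
    maxShuffle-iter-first zero    v k≡0 _      = toℕ-injective k≡0
    maxShuffle-iter-first (suc j) v k≡  stable =
      trans (cong (λ u → u ⟨$⟩ʳ Fin.zero) (iter-suc M j v)) (maxShuffle-iter-first j (M v) k′≡ stable′)
      where
      k′≡ = proj₁ (maxShuffle-step v j k≡ stable)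
      stable′ = proj₂ (maxShuffle-step v j k≡ stable)

    segmentStable-first : ∀ w → first (M w) ≤ first w → SegmentStable w (toℕ (first w))
    segmentStable-first w _ Fin.zero _ = ≤-refl
    segmentStable-first w Mw≤w (Fin.suc i) i<k =
      ≤-trans (≤maxPrefix w (Fin.suc i) (s≤s z≤n) i<k)
              (subst (ℕ._≤ toℕ (first w)) (proj₂ isMax w k≢0) Mw≤w)
      where
      k≢0 : first w ≢ Fin.zero
      k≢0 k≡0 = n≮0 (subst (suc (toℕ i) ℕ.≤_) (cong toℕ k≡0) i<k)

lemma8 : (n : ℕ) (M : S (suc n) → S (suc n)) → IsMaxShuffle M →
         (w : S (suc n)) → first (M w) ≤ first w →
         iter M (toℕ (first w)) w ⟨$⟩ʳ Fin.zero ≡ Fin.zero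
lemma8 n M isMax w Mw≤w =
  maxShuffle-iter-first M isMax (toℕ (first w)) w refl (segmentStable-first M isMax w Mw≤w)
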